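{- Let $g$ be a cubic graph and let $e,f$ be edges of $g$, where $e$ has endpoints $e_1,e_2$, the other neighbours of $e_1$ being $v_1,v_2$ and of $e_2$ being $v_3,v_4$, and $f$ has endpoints $f_1,f_2$, the other neighbours of $f_1$ being $w_1,w_2$ and of $f_2$ being $w_3,w_4$. Let $k\in\{1,2\}$ and suppose there is a graph isomorphism $\psi:w_e^k(g)\to w_f^k(g)$ with $\psi(e)=f$, $\psi(e_i)=f_i$ for $i=1,2$ and $\psi(v_i)=w_i$ for $i=1,\dots,4$. Then there exists an automorphism $\overline{\psi}$ of $g$ with $\overline{\psi}(e)=f$.
   Context: A cubic graph is a finite graph in which every vertex has degree $3$ (multiple edges and loops allowed). A Whitehead move does not change the vertex set, so the vertices $e_i,v_i$ (resp. $f_i,w_i$) are also vertices of $w_e^k(g)$ (resp. $w_f^k(g)$), and $e$ (resp. $f$) still denotes the edge joining $e_1,e_2$ (resp. $f_1,f_2$). The move $w_e^1$ replaces the edges $e_1v_2$, $e_2v_3$ by $e_1v_3$, $e_2v_2$, so that $e_1$ becomes adjacent to $v_1,v_3,e_2$ and $e_2$ to $v_2,v_4,e_1$; the move $w_e^2$ makes $e_1$ adjacent to $v_1,v_4,e_2$ and $e_2$ adjacent to $v_2,v_3,e_1$. All other edges are unchanged. The moves $w_f^1,w_f^2$ are defined in the same way with $f_i,w_i$ in place of $e_i,v_i$. -}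

module Defs where

open import Data.Nat using (ℕ)
open import Data.Fin using (Fin; zero; suc)
open import Data.Product using (_×_; _,_; proj₁; proj₂; Σ)
open import Data.Product.Properties using (≡-dec)
open import Data.Sum using (_⊎_)
open import Relation.Binary.PropositionalEquality using (_≡_; _≢_)
open import Relation.Nullary using (yes; no)
open import Function.Bundles using (_↔_; Inverse)
import Data.Fin as F

-- Cubic (multi)graphs with loops and multiple edges, in half-edge ("dart")
-- form.  Vertices are Fin n; every vertex v carries exactly three darts
-- (v , 0), (v , 1), (v , 2), so every vertex has degree 3 (a loop uses two
-- darts of its vertex, i.e. counts twice).  The edges are the orbits
-- {d , ι d} of a fixed-point-free involution ι on the darts.

Dart : ℕ → Set
Dart n = Fin n × Fin 3

vert : ∀ {n} → Dart n → Fin n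
vert = proj₁

_≟D_ : ∀ {n} (x y : Dart n) → Relation.Nullary.Dec (x ≡ y)
_≟D_ = ≡-dec F._≟_ F._≟_

record CubicGraph (n : ℕ) : Set where
  field
    ι       : Dart n → Dart n
    ι-invol : ∀ d → ι (ι d) ≡ d
    ι-nofix : ∀ d → ι d ≢ d
open CubicGraph public

-- Labelling of an edge e as in the paper: e is the edge {a , ι a},
-- e₁ = vert a, e₂ = vert (ι a); the other darts at e₁ are b₁, b₂ (leading to
-- v₁, v₂), the other darts at e₂ are c₃, c₄ (leading to v₃, v₄).
record EdgeFrame {n : ℕ} (g : CubicGraph n) : Set where
  field
    a b₁ b₂ c₃ c₄ : Dart n
    b₁-at : vert b₁ ≡ vert a
    b₂-at : vert b₂ ≡ vert a
    c₃-at : vert c₃ ≡ vert (ι g a)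
    c₄-at : vert c₄ ≡ vert (ι g a)
    a≢b₁ : a ≢ b₁
    a≢b₂ : a ≢ b₂
    b₁≢b₂ : b₁ ≢ b₂
    ιa≢c₃ : ι g a ≢ c₃
    ιa≢c₄ : ι g a ≢ c₄
    c₃≢c₄ : c₃ ≢ c₄
    nonloop : vert a ≢ vert (ι g a)

  e₁ e₂ v₁ v₂ v₃ v₄ : Fin n
  e₁ = vert a
  e₂ = vert (ι g a)
  v₁ = vert (ι g b₁)
  v₂ = vert (ι g b₂)
  v₃ = vert (ι g c₃)
  v₄ = vert (ι g c₄)
open EdgeFrame public

reconnect : ∀ {n} → (Dart n → Dart n) → Dart n → Dart n → Dart n → Dart n
reconnect ι x y d with d ≟D x
... | yes _ = ι y
... | no _ with d ≟D ι y
... | yes _ = x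
... | no _ with d ≟D y
... | yes _ = ι x
... | no _ with d ≟D ι x
... | yes _ = y
... | no _ = ι d

-- k = 1 is represented by zero, k = 2 by suc zero.
-- w^1 : edges e₁v₂ (dart b₂), e₂v₃ (dart c₃) become e₁v₃, e₂v₂.
-- w^2 : edges e₁v₂ (dart b₂), e₂v₄ (dart c₄) become e₁v₄, e₂v₂.
moveDart : ∀ {n} {g : CubicGraph n} → Fin 2 → EdgeFrame g → Dart n
moveDart zero F = c₃ F
moveDart (suc _) F = c₄ F

IsWhitehead : ∀ {n} (k : Fin 2) (g : CubicGraph n) (E : EdgeFrame g)
              (h : CubicGraph n) → Set
IsWhitehead k g E h = ∀ d → ι h d ≡ reconnect (ι g) (b₂ E) (moveDart k E) d

record Iso {n m : ℕ} (g : CubicGraph n) (h : CubicGraph m) : Set where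
  field
    vmap : Fin n ↔ Fin m
    dmap : Dart n ↔ Dart m
    vert-hom : ∀ d → vert (Inverse.to dmap d) ≡ Inverse.to vmap (vert d)
    ι-hom : ∀ d → Inverse.to dmap (ι g d) ≡ ι h (Inverse.to dmap d)

  vfun : Fin n → Fin m
  vfun = Inverse.to vmap
  dfun : Dart n → Dart m
  dfun = Inverse.to dmap
open Iso public

Automorphism : ∀ {n} → CubicGraph n → Set
Automorphism g = Iso g g

MapsEdge : ∀ {n m} {g : CubicGraph n} {h : CubicGraph m} → Iso g h →
           Dart n → Dart m → Set
MapsEdge {h = h} ψ a a' = dfun ψ a ≡ a' ⊎ dfun ψ a ≡ ι h a'

-- Reconnecting the same two edges {b₂ , ι b₂} and {c , ι c} (c = c₃ or c₄)
-- once more turns w_e^k(g) back into g, and reconnection commutes with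
-- isomorphisms.  Hence an isomorphism w_e^k(g) → w_f^k(g) sending the darts
-- b₂, c of e to those of f is also an automorphism of g.  The hypotheses only
-- control ψ on vertices, and because of multiple edges ψ(b₂) may be an edge
-- parallel to b₂ of f rather than b₂ itself (likewise for c).  Composing ψ
-- with the automorphism of w_f^k(g) that exchanges two parallel edges repairs
-- this, first for b₂ and then for c, and keeps ψ(a) = a of f.
module Submission where

open import Defs
open import Data.Nat using (ℕ)
open import Data.Fin using (Fin; zero; suc)
open import Data.Product using (Σ; _×_; _,_)
open import Data.Sum using (inj₁; inj₂)
open import Data.Empty using (⊥-elim)
open import Relation.Nullary using (yes; no)
open import Relation.Binary.PropositionalEquality
open import Function.Bundles using (Injection; mk↔ₛ′)
open import Function.Construct.Composition using (_↔-∘_)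
open import Function.Construct.Identity using (↔-id)
open import Function.Properties.Inverse using (↔⇒↣)

module _ {n : ℕ} (g : CubicGraph n) where

  ι-transpose : ∀ {d e} → ι g d ≡ e → d ≡ ι g e
  ι-transpose {d} ιd≡e = trans (sym (ι-invol g d)) (cong (ι g) ιd≡e)

  ι-injective : ∀ {d e} → ι g d ≡ ι g e → d ≡ e
  ι-injective {e = e} ιd≡ιe = trans (ι-transpose ιd≡ιe) (ι-invol g e)

  reconnect-at-x : ∀ x y → reconnect (ι g) x y x ≡ ι g y
  reconnect-at-x x y with x ≟D x
  ... | yes _ = refl
  ... | no x≢x = ⊥-elim (x≢x refl)

  reconnect-at-ιy : ∀ x y → reconnect (ι g) x y (ι g y) ≡ x
  reconnect-at-ιy x y with ι g y ≟D x
  ... | yes ιy≡x = ιy≡x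
  ... | no _ with ι g y ≟D ι g y
  ... | yes _ = refl
  ... | no ιy≢ιy = ⊥-elim (ιy≢ιy refl)

  reconnect-at-y : ∀ x y → reconnect (ι g) x y y ≡ ι g x
  reconnect-at-y x y with y ≟D x
  ... | yes y≡x = cong (ι g) y≡x
  ... | no _ with y ≟D ι g y
  ... | yes y≡ιy = ⊥-elim (ι-nofix g y (sym y≡ιy))
  ... | no _ with y ≟D y
  ... | yes _ = refl
  ... | no y≢y = ⊥-elim (y≢y refl)

  reconnect-at-ιx : ∀ x y → reconnect (ι g) x y (ι g x) ≡ y
  reconnect-at-ιx x y with ι g x ≟D x
  ... | yes ιx≡x = ⊥-elim (ι-nofix g x ιx≡x)
  ... | no _ with ι g x ≟D ι g y
  ... | yes ιx≡ιy = ι-injective ιx≡ιy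
  ... | no _ with ι g x ≟D y
  ... | yes ιx≡y = ιx≡y
  ... | no _ with ι g x ≟D ι g x
  ... | yes _ = refl
  ... | no ιx≢ιx = ⊥-elim (ιx≢ιx refl)

  reconnect-elsewhere : ∀ x y d → d ≢ x → d ≢ ι g y → d ≢ y → d ≢ ι g x →
                        reconnect (ι g) x y d ≡ ι g d
  reconnect-elsewhere x y d d≢x d≢ιy d≢y d≢ιx with d ≟D x
  ... | yes d≡x = ⊥-elim (d≢x d≡x)
  ... | no _ with d ≟D ι g y
  ... | yes d≡ιy = ⊥-elim (d≢ιy d≡ιy)
  ... | no _ with d ≟D y
  ... | yes d≡y = ⊥-elim (d≢y d≡y)
  ... | no _ with d ≟D ι g x
  ... | yes d≡ιx = ⊥-elim (d≢ιx d≡ιx)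
  ... | no _ = refl

  reconnect-reconnect : (h : CubicGraph n) → ∀ x y →
                        (∀ d → ι h d ≡ reconnect (ι g) x y d) →
                        ∀ d → reconnect (ι h) x y d ≡ ι g d
  reconnect-reconnect h x y hg = undo
    where
    ι-h-x : ι h x ≡ ι g y
    ι-h-x = trans (hg x) (reconnect-at-x x y)

    ι-h-y : ι h y ≡ ι g x
    ι-h-y = trans (hg y) (reconnect-at-y x y)

    undo : ∀ d → reconnect (ι h) x y d ≡ ι g d
    undo d with d ≟D x
    ... | yes refl = ι-h-y
    ... | no d≢x with d ≟D ι h y
    ... | yes refl = ι-transpose (sym ι-h-y)
    ... | no d≢ι-h-y with d ≟D y
    ... | yes refl = ι-h-x
    ... | no d≢y with d ≟D ι h x
    ... | yes refl = ι-transpose (sym ι-h-x)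
    ... | no d≢ι-h-x = trans (hg d) (reconnect-elsewhere x y d d≢x
            (λ d≡ιy → d≢ι-h-x (trans d≡ιy (sym ι-h-x))) d≢y
            (λ d≡ιx → d≢ι-h-y (trans d≡ιx (sym ι-h-y))))

_∘ᴵ_ : ∀ {n m l} {g : CubicGraph n} {h : CubicGraph m} {k : CubicGraph l} →
       Iso h k → Iso g h → Iso g k
φ ∘ᴵ ψ = record
  { vmap = vmap φ ↔-∘ vmap ψ
  ; dmap = dmap φ ↔-∘ dmap ψ
  ; vert-hom = λ d → trans (vert-hom φ (dfun ψ d)) (cong (vfun φ) (vert-hom ψ d))
  ; ι-hom = λ d → trans (cong (dfun φ) (ι-hom ψ d)) (ι-hom φ (dfun ψ d))
  }

module _ {n m : ℕ} {h : CubicGraph n} {h' : CubicGraph m} (φ : Iso h h') where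

  dfun-injective : ∀ {d d'} → dfun φ d ≡ dfun φ d' → d ≡ d'
  dfun-injective = Injection.injective (↔⇒↣ (dmap φ))

  dfun-reconnect : ∀ x y d → dfun φ (reconnect (ι h) x y d) ≡
                   reconnect (ι h') (dfun φ x) (dfun φ y) (dfun φ d)
  dfun-reconnect x y d with d ≟D x
  ... | yes refl = trans (ι-hom φ y) (sym (reconnect-at-x h' (dfun φ x) (dfun φ y)))
  ... | no d≢x with d ≟D ι h y
  ... | yes refl = sym (trans (cong (reconnect (ι h') (dfun φ x) (dfun φ y)) (ι-hom φ y))
                              (reconnect-at-ιy h' (dfun φ x) (dfun φ y)))
  ... | no d≢ιy with d ≟D y
  ... | yes refl = trans (ι-hom φ x) (sym (reconnect-at-y h' (dfun φ x) (dfun φ y)))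
  ... | no d≢y with d ≟D ι h x
  ... | yes refl = sym (trans (cong (reconnect (ι h') (dfun φ x) (dfun φ y)) (ι-hom φ x))
                              (reconnect-at-ιx h' (dfun φ x) (dfun φ y)))
  ... | no d≢ιx = trans (ι-hom φ d) (sym (reconnect-elsewhere h' (dfun φ x) (dfun φ y) (dfun φ d)
          (λ eq → d≢x (dfun-injective eq))
          (λ eq → d≢ιy (dfun-injective (trans eq (sym (ι-hom φ y)))))
          (λ eq → d≢y (dfun-injective eq))
          (λ eq → d≢ιx (dfun-injective (trans eq (sym (ι-hom φ x)))))))

  reconnect-iso : {g : CubicGraph n} {g' : CubicGraph m} {x y : Dart n} {x' y' : Dart m} →
                  dfun φ x ≡ x' → dfun φ y ≡ y' →
                  (∀ d → ι g d ≡ reconnect (ι h) x y d) →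
                  (∀ d → ι g' d ≡ reconnect (ι h') x' y' d) → Iso g g'
  reconnect-iso {g} {g'} {x} {y} {x'} {y'} φx φy hg hg' = record
    { vmap = vmap φ
    ; dmap = dmap φ
    ; vert-hom = vert-hom φ
    ; ι-hom = ι-hom-g
    }
    where
    open ≡-Reasoning
    ι-hom-g : ∀ d → dfun φ (ι g d) ≡ ι g' (dfun φ d)
    ι-hom-g d = begin
      dfun φ (ι g d)                                    ≡⟨ cong (dfun φ) (hg d) ⟩
      dfun φ (reconnect (ι h) x y d)                    ≡⟨ dfun-reconnect x y d ⟩
      reconnect (ι h') (dfun φ x) (dfun φ y) (dfun φ d)
        ≡⟨ cong₂ (λ u v → reconnect (ι h') u v (dfun φ d)) φx φy ⟩
      reconnect (ι h') x' y' (dfun φ d)                 ≡⟨ sym (hg' (dfun φ d)) ⟩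
      ι g' (dfun φ d)                                   ∎

module EdgeSwap {n : ℕ} (h : CubicGraph n) (x y : Dart n) where

  swap : Dart n → Dart n
  swap d with d ≟D x
  ... | yes _ = y
  ... | no _ with d ≟D y
  ... | yes _ = x
  ... | no _ with ι h d ≟D x
  ... | yes _ = ι h y
  ... | no _ with ι h d ≟D y
  ... | yes _ = ι h x
  ... | no _ = d

  swap-x : swap x ≡ y
  swap-x with x ≟D x
  ... | yes _ = refl
  ... | no x≢x = ⊥-elim (x≢x refl)

  swap-y : swap y ≡ x
  swap-y with y ≟D x
  ... | yes y≡x = y≡x
  ... | no _ with y ≟D y
  ... | yes _ = refl
  ... | no y≢y = ⊥-elim (y≢y refl)

  swap-ιx : swap (ι h x) ≡ ι h y
  swap-ιx with ι h x ≟D x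
  ... | yes ιx≡x = ⊥-elim (ι-nofix h x ιx≡x)
  ... | no _ with ι h x ≟D y
  ... | yes ιx≡y = ι-transpose h ιx≡y
  ... | no _ with ι h (ι h x) ≟D x
  ... | yes _ = refl
  ... | no ιιx≢x = ⊥-elim (ιιx≢x (ι-invol h x))

  swap-ιy : swap (ι h y) ≡ ι h x
  swap-ιy with ι h y ≟D x
  ... | yes ιy≡x = ι-transpose h ιy≡x
  ... | no _ with ι h y ≟D y
  ... | yes ιy≡y = ⊥-elim (ι-nofix h y ιy≡y)
  ... | no _ with ι h (ι h y) ≟D x
  ... | yes ιιy≡x = cong (ι h) (trans (sym (ι-invol h y)) ιιy≡x)
  ... | no _ with ι h (ι h y) ≟D y
  ... | yes _ = refl
  ... | no ιιy≢y = ⊥-elim (ιιy≢y (ι-invol h y))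

  swap-elsewhere : ∀ d → d ≢ x → d ≢ y → d ≢ ι h x → d ≢ ι h y → swap d ≡ d
  swap-elsewhere d d≢x d≢y d≢ιx d≢ιy with d ≟D x
  ... | yes d≡x = ⊥-elim (d≢x d≡x)
  ... | no _ with d ≟D y
  ... | yes d≡y = ⊥-elim (d≢y d≡y)
  ... | no _ with ι h d ≟D x
  ... | yes ιd≡x = ⊥-elim (d≢ιx (ι-transpose h ιd≡x))
  ... | no _ with ι h d ≟D y
  ... | yes ιd≡y = ⊥-elim (d≢ιy (ι-transpose h ιd≡y))
  ... | no _ = refl

  private
    data Position (d : Dart n) : Set where
      at-x : d ≡ x → Position d
      at-y : d ≡ y → Position d
      at-ιx : d ≡ ι h x → Position d
      at-ιy : d ≡ ι h y → Position d
      elsewhere : d ≢ x → d ≢ y → d ≢ ι h x → d ≢ ι h y → Position d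

    position : ∀ d → Position d
    position d with d ≟D x
    ... | yes d≡x = at-x d≡x
    ... | no d≢x with d ≟D y
    ... | yes d≡y = at-y d≡y
    ... | no d≢y with d ≟D ι h x
    ... | yes d≡ιx = at-ιx d≡ιx
    ... | no d≢ιx with d ≟D ι h y
    ... | yes d≡ιy = at-ιy d≡ιy
    ... | no d≢ιy = elsewhere d≢x d≢y d≢ιx d≢ιy

  swap-ι : ∀ d → swap (ι h d) ≡ ι h (swap d)
  swap-ι d with position d
  ... | at-x refl = trans swap-ιx (cong (ι h) (sym swap-x))
  ... | at-y refl = trans swap-ιy (cong (ι h) (sym swap-y))
  ... | at-ιx refl = trans (cong swap (ι-invol h x))
                       (trans swap-x (ι-transpose h (sym swap-ιx)))
  ... | at-ιy refl = trans (cong swap (ι-invol h y))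
                       (trans swap-y (ι-transpose h (sym swap-ιy)))
  ... | elsewhere d≢x d≢y d≢ιx d≢ιy = trans
          (swap-elsewhere (ι h d)
            (λ ιd≡x → d≢ιx (ι-transpose h ιd≡x))
            (λ ιd≡y → d≢ιy (ι-transpose h ιd≡y))
            (λ ιd≡ιx → d≢x (ι-injective h ιd≡ιx))
            (λ ιd≡ιy → d≢y (ι-injective h ιd≡ιy)))
          (cong (ι h) (sym (swap-elsewhere d d≢x d≢y d≢ιx d≢ιy)))

  swap-involutive : ∀ d → swap (swap d) ≡ d
  swap-involutive d with position d
  ... | at-x refl = trans (cong swap swap-x) swap-y
  ... | at-y refl = trans (cong swap swap-y) swap-x
  ... | at-ιx refl = trans (cong swap swap-ιx) swap-ιy
  ... | at-ιy refl = trans (cong swap swap-ιy) swap-ιx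
  ... | elsewhere d≢x d≢y d≢ιx d≢ιy =
          trans (cong swap (swap-elsewhere d d≢x d≢y d≢ιx d≢ιy)) (swap-elsewhere d d≢x d≢y d≢ιx d≢ιy)

  vert-swap : vert x ≡ vert y → vert (ι h x) ≡ vert (ι h y) → ∀ d → vert (swap d) ≡ vert d
  vert-swap vx vιx d with position d
  ... | at-x refl = trans (cong vert swap-x) (sym vx)
  ... | at-y refl = trans (cong vert swap-y) vx
  ... | at-ιx refl = trans (cong vert swap-ιx) (sym vιx)
  ... | at-ιy refl = trans (cong vert swap-ιy) vιx
  ... | elsewhere d≢x d≢y d≢ιx d≢ιy = cong vert (swap-elsewhere d d≢x d≢y d≢ιx d≢ιy)

  swapAut : vert x ≡ vert y → vert (ι h x) ≡ vert (ι h y) → Automorphism h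
  swapAut vx vιx = record
    { vmap = ↔-id (Fin n)
    ; dmap = mk↔ₛ′ swap swap swap-involutive swap-involutive
    ; vert-hom = vert-swap vx vιx
    ; ι-hom = swap-ι
    }

module Realign {n m : ℕ} {h : CubicGraph n} {h' : CubicGraph m} (φ : Iso h h')
               (x : Dart n) (y : Dart m)
               (vert-x : vfun φ (vert x) ≡ vert y)
               (vert-ιx : vfun φ (vert (ι h x)) ≡ vert (ι h' y)) where

  open EdgeSwap h' (dfun φ x) y

  realign : Iso h h'
  realign = swapAut (trans (vert-hom φ x) vert-x)
                    (trans (trans (cong vert (sym (ι-hom φ x))) (vert-hom φ (ι h x))) vert-ιx)
            ∘ᴵ φ

  realign-x : dfun realign x ≡ y
  realign-x = swap-x

  realign-elsewhere : ∀ {d d'} → dfun φ d ≡ d' → d ≢ x → d ≢ ι h x →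
                      d' ≢ y → d' ≢ ι h' y → dfun realign d ≡ d'
  realign-elsewhere refl d≢x d≢ιx d'≢y d'≢ιy = swap-elsewhere _
    (λ eq → d≢x (dfun-injective φ eq)) d'≢y
    (λ eq → d≢ιx (dfun-injective φ (trans eq (sym (ι-hom φ x))))) d'≢ιy

mapsEdge-oriented : ∀ {n m} {h : CubicGraph n} {h' : CubicGraph m} (ψ : Iso h h') {a a'} →
                    MapsEdge ψ a a' → vfun ψ (vert a) ≡ vert a' → vert a' ≢ vert (ι h' a') →
                    dfun ψ a ≡ a'
mapsEdge-oriented ψ (inj₁ ψa≡a') _ _ = ψa≡a'
mapsEdge-oriented ψ {a} (inj₂ ψa≡ιa') va nonloop' =
  ⊥-elim (nonloop' (trans (sym va) (trans (sym (vert-hom ψ a)) (cong vert ψa≡ιa'))))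

module _ {n : ℕ} {g : CubicGraph n} where

  moveDart-at : ∀ k (X : EdgeFrame g) → vert (moveDart k X) ≡ e₂ X
  moveDart-at zero X = c₃-at X
  moveDart-at (suc _) X = c₄-at X

  ιa≢moveDart : ∀ k (X : EdgeFrame g) → ι g (a X) ≢ moveDart k X
  ιa≢moveDart zero X = ιa≢c₃ X
  ιa≢moveDart (suc _) X = ιa≢c₄ X

  map-moved-neighbour : ∀ k (E F : EdgeFrame g) (f : Fin n → Fin n) →
                         f (v₃ E) ≡ v₃ F → f (v₄ E) ≡ v₄ F →
                         f (vert (ι g (moveDart k E))) ≡ vert (ι g (moveDart k F))
  map-moved-neighbour zero E F f f-v₃ f-v₄ = f-v₃
  map-moved-neighbour (suc _) E F f f-v₃ f-v₄ = f-v₄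

  ends-distinct : (X : EdgeFrame g) {d d' : Dart n} → vert d ≡ e₁ X → vert d' ≡ e₂ X → d ≢ d'
  ends-distinct X d-at d'-at refl = nonloop X (trans (sym d-at) d'-at)

  a≢moveDart : ∀ k (X : EdgeFrame g) → a X ≢ moveDart k X
  a≢moveDart k X = ends-distinct X refl (moveDart-at k X)

  b₂≢moveDart : ∀ k (X : EdgeFrame g) → b₂ X ≢ moveDart k X
  b₂≢moveDart k X = ends-distinct X (b₂-at X) (moveDart-at k X)

  a≢ι-b₂ : (X : EdgeFrame g) → a X ≢ ι g (b₂ X)
  a≢ι-b₂ X a≡ιb₂ = ends-distinct X (b₂-at X) refl (ι-transpose g (sym a≡ιb₂))

  a≢ι-moveDart : ∀ k (X : EdgeFrame g) → a X ≢ ι g (moveDart k X)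
  a≢ι-moveDart k X a≡ιc = ιa≢moveDart k X (sym (ι-transpose g (sym a≡ιc)))

module Whitehead {n : ℕ} {g : CubicGraph n} (k : Fin 2) (X : EdgeFrame g) (h : CubicGraph n)
                 (w : IsWhitehead k g X h) where

  partner-b₂ : ι h (b₂ X) ≡ ι g (moveDart k X)
  partner-b₂ = trans (w (b₂ X)) (reconnect-at-x g (b₂ X) (moveDart k X))

  partner-moveDart : ι h (moveDart k X) ≡ ι g (b₂ X)
  partner-moveDart = trans (w (moveDart k X)) (reconnect-at-y g (b₂ X) (moveDart k X))

  reconnect-back : ∀ d → ι g d ≡ reconnect (ι h) (b₂ X) (moveDart k X) d
  reconnect-back d = sym (reconnect-reconnect g h (b₂ X) (moveDart k X) w d)

  partner-a : ι h (a X) ≡ ι g (a X)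
  partner-a = trans (w (a X)) (reconnect-elsewhere g (b₂ X) (moveDart k X) (a X)
    (a≢b₂ X) (a≢ι-moveDart k X) (a≢moveDart k X) (a≢ι-b₂ X))

  a≢partner-b₂ : a X ≢ ι h (b₂ X)
  a≢partner-b₂ eq = a≢ι-moveDart k X (trans eq partner-b₂)

  a≢partner-moveDart : a X ≢ ι h (moveDart k X)
  a≢partner-moveDart eq = a≢ι-b₂ X (trans eq partner-moveDart)

  b₂≢partner-moveDart : b₂ X ≢ ι h (moveDart k X)
  b₂≢partner-moveDart eq = ι-nofix g (b₂ X) (sym (trans eq partner-moveDart))

module _ {n : ℕ} {g : CubicGraph n} (k : Fin 2) (E F : EdgeFrame g) {hₑ h_f : CubicGraph n}
         (wE : IsWhitehead k g E hₑ) (wF : IsWhitehead k g F h_f) where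

  private
    module WE = Whitehead k E hₑ wE
    module WF = Whitehead k F h_f wF

  align-reconnected-darts :
    (ψ : Iso hₑ h_f) → dfun ψ (a E) ≡ a F →
    vfun ψ (e₁ E) ≡ e₁ F → vfun ψ (e₂ E) ≡ e₂ F → vfun ψ (v₂ E) ≡ v₂ F →
    vfun ψ (v₃ E) ≡ v₃ F → vfun ψ (v₄ E) ≡ v₄ F →
    Σ (Iso hₑ h_f) λ φ → dfun φ (a E) ≡ a F × dfun φ (b₂ E) ≡ b₂ F ×
                         dfun φ (moveDart k E) ≡ moveDart k F
  align-reconnected-darts ψ ψ-a ψ-e₁ ψ-e₂ ψ-v₂ ψ-v₃ ψ-v₄ =
    R₂.realign , ψ₂-a , ψ₂-b₂ , R₂.realign-x
    where
    vfun-vert-ι : ∀ {x y x' y'} → ι hₑ x ≡ x' → ι h_f y ≡ y' →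
                  vfun ψ (vert x') ≡ vert y' → vfun ψ (vert (ι hₑ x)) ≡ vert (ι h_f y)
    vfun-vert-ι refl refl eq = eq

    module R₁ = Realign ψ (b₂ E) (b₂ F)
      (trans (cong (vfun ψ) (b₂-at E)) (trans ψ-e₁ (sym (b₂-at F))))
      (vfun-vert-ι WE.partner-b₂ WF.partner-b₂
        (map-moved-neighbour k E F (vfun ψ) ψ-v₃ ψ-v₄))

    module R₂ = Realign R₁.realign (moveDart k E) (moveDart k F)
      (trans (cong (vfun ψ) (moveDart-at k E)) (trans ψ-e₂ (sym (moveDart-at k F))))
      (vfun-vert-ι WE.partner-moveDart WF.partner-moveDart ψ-v₂)

    ψ₂-a : dfun R₂.realign (a E) ≡ a F
    ψ₂-a = R₂.realign-elsewhere
      (R₁.realign-elsewhere ψ-a (a≢b₂ E) WE.a≢partner-b₂ (a≢b₂ F) WF.a≢partner-b₂)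
      (a≢moveDart k E) WE.a≢partner-moveDart (a≢moveDart k F) WF.a≢partner-moveDart

    ψ₂-b₂ : dfun R₂.realign (b₂ E) ≡ b₂ F
    ψ₂-b₂ = R₂.realign-elsewhere R₁.realign-x
      (b₂≢moveDart k E) WE.b₂≢partner-moveDart
      (b₂≢moveDart k F) WF.b₂≢partner-moveDart

proposition5p2 : ∀ {n : ℕ} (g : CubicGraph n) (E F : EdgeFrame g) (k : Fin 2)
    (hₑ h_f : CubicGraph n) → IsWhitehead k g E hₑ → IsWhitehead k g F h_f →
    (ψ : Iso hₑ h_f) → MapsEdge ψ (a E) (a F) →
    vfun ψ (e₁ E) ≡ e₁ F → vfun ψ (e₂ E) ≡ e₂ F →
    vfun ψ (v₁ E) ≡ v₁ F → vfun ψ (v₂ E) ≡ v₂ F →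
    vfun ψ (v₃ E) ≡ v₃ F → vfun ψ (v₄ E) ≡ v₄ F →
    Σ (Automorphism g) (λ ψ̄ → MapsEdge ψ̄ (a E) (a F))
proposition5p2 g E F k hₑ h_f wE wF ψ ψ-maps-e ψ-e₁ ψ-e₂ _ ψ-v₂ ψ-v₃ ψ-v₄ =
  let φ , φ-a , φ-b₂ , φ-c = align-reconnected-darts k E F wE wF ψ ψ-a ψ-e₁ ψ-e₂ ψ-v₂ ψ-v₃ ψ-v₄
  in reconnect-iso φ φ-b₂ φ-c WE.reconnect-back WF.reconnect-back , inj₁ φ-a
  where
  module WE = Whitehead k E hₑ wE
  module WF = Whitehead k F h_f wF

  ψ-a : dfun ψ (a E) ≡ a F
  ψ-a = mapsEdge-oriented ψ ψ-maps-e ψ-e₁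
          (λ eq → nonloop F (trans eq (cong vert WF.partner-a)))
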